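{- Let $q$ be a prime power and let $k<v$ be positive integers. Let $\mathcal{N}$ be a set of $k$-dimensional subspaces of $\mathbb{F}_q^v$ which pairwise intersect trivially and which together span $\mathbb{F}_q^v$. For each integer $i$, let $a_i$ denote the number of hyperplanes $H$ of $\mathbb{F}_q^v$ such that exactly $i$ elements of $\mathcal{N}$ are contained in $H$. Suppose there is an integer $r>0$ such that $a_i=0$ for all $i\neq r$. Then there exists an integer $s\ge 2$ with $v=sk$, the set $\mathcal{N}$ is a $k$-spread of $\mathbb{F}_q^v$ (i.e., every non-zero vector of $\mathbb{F}_q^v$ lies in exactly one element of $\mathcal{N}$), and $r=\frac{q^{v-k}-1}{q^k-1}$.
   Context: A hyperplane of $\mathbb{F}_q^v$ is a $(v-1)$-dimensional subspace. -}

module Defs where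

open import Level using (0ℓ)
open import Algebra.Bundles using (CommutativeRing)
open import Data.Nat using (ℕ; zero; suc; _≤_; _^_)
open import Data.Fin using (Fin)
import Data.Fin as Fin
open import Data.Fin.Subset using (Subset; _∈_; ∣_∣)
open import Data.Nat.Primality using (Prime)
open import Data.Product using (Σ; ∃; ∃-syntax; _×_)
open import Relation.Nullary using (¬_)
open import Relation.Binary.PropositionalEquality using (_≡_; _≢_)

IsPrimePower : ℕ → Set
IsPrimePower q = ∃[ p ] ∃[ e ] (Prime p × 1 ≤ e × q ≡ p ^ e)

record IsField (R : CommutativeRing 0ℓ 0ℓ) : Set where
  open CommutativeRing R
  field
    1≉0     : ¬ (1# ≈ 0#)
    inverse : ∀ x → ¬ (x ≈ 0#) → ∃[ y ] (x * y ≈ 1#)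

record HasSize (R : CommutativeRing 0ℓ 0ℓ) (q : ℕ) : Set where
  open CommutativeRing R
  field
    enum : Fin q → Carrier
    surj : ∀ x → ∃[ i ] (enum i ≈ x)
    inj  : ∀ i j → enum i ≈ enum j → i ≡ j

module Linear (R : CommutativeRing 0ℓ 0ℓ) where
  open CommutativeRing R

  Vect : ℕ → Set
  Vect v = Fin v → Carrier

  _≈ᵥ_ : ∀ {v} → Vect v → Vect v → Set
  x ≈ᵥ y = ∀ i → x i ≈ y i

  0ᵥ : ∀ {v} → Vect v
  0ᵥ _ = 0#

  _+ᵥ_ : ∀ {v} → Vect v → Vect v → Vect v
  (x +ᵥ y) i = x i + y i

  _·_ : ∀ {v} → Carrier → Vect v → Vect v
  (a · x) i = a * x i

  vsum : ∀ {m v} → (Fin m → Vect v) → Vect v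
  vsum {zero}  f = 0ᵥ
  vsum {suc m} f = f Fin.zero +ᵥ vsum (λ j → f (Fin.suc j))

  lincomb : ∀ {m v} → (Fin m → Carrier) → (Fin m → Vect v) → Vect v
  lincomb c b = vsum (λ j → c j · b j)

  record IsSubspace {v} (W : Vect v → Set) : Set where
    field
      resp  : ∀ {x y} → x ≈ᵥ y → W x → W y
      has0  : W 0ᵥ
      add   : ∀ {x y} → W x → W y → W (x +ᵥ y)
      scale : ∀ a {x} → W x → W (a · x)

  LinIndep : ∀ {m v} → (Fin m → Vect v) → Set
  LinIndep b = ∀ c → lincomb c b ≈ᵥ 0ᵥ → ∀ i → c i ≈ 0#

  IsBasis : ∀ {m v} → (Vect v → Set) → (Fin m → Vect v) → Set
  IsBasis W b = LinIndep b × (∀ x → (W x → ∃[ c ] (x ≈ᵥ lincomb c b))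
                                  × (∃[ c ] (x ≈ᵥ lincomb c b) → W x))

  HasDim : ∀ {v} → (Vect v → Set) → ℕ → Set
  HasDim {v} W k = IsSubspace W × Σ (Fin k → Vect v) (IsBasis W)

  IsHyperplane : ∀ {v} → (Vect v → Set) → Set
  IsHyperplane {v} H = HasDim H (v Data.Nat.∸ 1)

  _⊆_ : ∀ {v} → (Vect v → Set) → (Vect v → Set) → Set
  W ⊆ U = ∀ x → W x → U x

  PairwiseTrivial : ∀ {n v} → (Fin n → Vect v → Set) → Set
  PairwiseTrivial N = ∀ i j → i ≢ j → ∀ x → N i x → N j x → x ≈ᵥ 0ᵥ

  Spans : ∀ {n v} → (Fin n → Vect v → Set) → Set
  Spans {n} {v} N = ∀ x → ∃[ y ] ((∀ (j : Fin n) → N j (y j)) × x ≈ᵥ vsum y)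

  IsSpread : ∀ {n v} → (Fin n → Vect v → Set) → Set
  IsSpread {n} N = ∀ x → ¬ (x ≈ᵥ 0ᵥ) → ∃[ j ] (N j x × (∀ (j' : Fin n) → N j' x → j' ≡ j))

  ContainsExactly : ∀ {n v} → (Vect v → Set) → (Fin n → Vect v → Set) → ℕ → Set
  ContainsExactly {n} H N r =
    ∃[ S ] (∣ S ∣ ≡ r × (∀ (j : Fin n) → (j ∈ S → N j ⊆ H) × (N j ⊆ H → j ∈ S)))

module Submission where

-- The hyperplanes include the kernels ker(a) = {x | a·x = 0} of the non-zero a ∈ F^v, and
-- N_j ⊆ ker(a) iff a annihilates a basis of N_j.  The key count: d independent vectors
-- have exactly q^(v-d) common annihilators (and d ≤ v), proved by Gaussian elimination.
-- Double counting the pairs (a, j) with a ≠ 0 annihilating N_j gives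
--   (1)  r (q^v - 1) = n (q^(v-k) - 1),
-- and doing the same only for the a annihilating a fixed N_j, where N_j + N_l has
-- dimension 2k for l ≠ j, gives
--   (2)  r (q^(v-k) - 1) = (q^(v-k) - 1) + (n - 1)(q^(v-2k) - 1).
-- Arithmetic turns (1) and (2) into n ≥ 2, 2k ≤ v, n (q^k - 1) = q^v - 1 and
-- r (q^k - 1) = q^(v-k) - 1.  The n members have q^k - 1 non-zero vectors each and share
-- none, so the first identity says they cover every non-zero vector: a spread.  It also
-- gives (q^k - 1) ∣ (q^v - 1), whence k ∣ v.  Vectors are enumerated by their coordinate words in (Fin q)^v,
-- so every count is a finite sum of indicators of decidable predicates.

open import Defs
open import Level using (0ℓ)
open import Algebra.Bundles using (CommutativeRing)
open import Data.Nat using (ℕ; _≤_)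
open import Data.Fin using (Fin)

module Indicators where

  open import Data.Nat using (ℕ; zero; suc; _+_; _*_)
  open import Data.Nat.Properties using (+-*-semiring; *-zeroʳ; +-assoc; +-comm; m+n≡0⇒m≡0; m+n≡0⇒n≡0)
  open import Data.Fin using (Fin; zero; suc)
  import Data.Fin.Properties as Fin
  open import Data.Fin.Subset using (Subset; ∣_∣; inside; outside)
  open import Data.Fin.Subset.Properties using (_∈?_)
  open import Data.Vec using ([]; _∷_; there)
  open import Data.Product using (∃; _,_)
  open import Data.Empty using (⊥-elim)
  open import Relation.Nullary using (¬_; Dec; yes; no; _×-dec_; ¬?)
  open import Relation.Binary.PropositionalEquality
  open import Function using (_∘_)

  open import Algebra.Properties.Semiring.Sum +-*-semiring public
    using (sum-cong-≋; ∑-distrib-+; ∑-comm; *-distribˡ-sum) renaming (sum to ∑ℕ)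

  ∑ℕ-cong : ∀ n {f g : Fin n → ℕ} → (∀ i → f i ≡ g i) → ∑ℕ f ≡ ∑ℕ g
  ∑ℕ-cong n = sum-cong-≋

  ind : ∀ {P : Set} → Dec P → ℕ
  ind (yes _) = 1
  ind (no _) = 0

  ind-⇔ : ∀ {P Q : Set} (d : Dec P) (e : Dec Q) → (P → Q) → (Q → P) → ind d ≡ ind e
  ind-⇔ (yes p) (yes q) f g = refl
  ind-⇔ (yes p) (no q) f g = ⊥-elim (q (f p))
  ind-⇔ (no p) (yes q) f g = ⊥-elim (p (g q))
  ind-⇔ (no p) (no q) f g = refl

  ind-yes : ∀ {P : Set} (d : Dec P) → P → ind d ≡ 1
  ind-yes (yes _) _ = refl
  ind-yes (no ¬p) p = ⊥-elim (¬p p)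

  ind-no : ∀ {P : Set} (d : Dec P) → ¬ P → ind d ≡ 0
  ind-no (yes p) ¬p = ⊥-elim (¬p p)
  ind-no (no _) _ = refl

  ind-× : ∀ {P Q : Set} (d : Dec P) (e : Dec Q) → ind (d ×-dec e) ≡ ind d * ind e
  ind-× (yes p) (yes q) = refl
  ind-× (yes p) (no q) = refl
  ind-× (no p) (yes q) = refl
  ind-× (no p) (no q) = refl

  ind-¬ : ∀ {P : Set} (d : Dec P) → ind d + ind (¬? d) ≡ 1
  ind-¬ (yes p) = refl
  ind-¬ (no p) = refl

  ∑ℕ-const : ∀ n c → ∑ℕ {n} (λ _ → c) ≡ n * c
  ∑ℕ-const zero c = refl
  ∑ℕ-const (suc n) c = cong (c +_) (∑ℕ-const n c)

  ∑ℕ-zero : ∀ n (f : Fin n → ℕ) → ∑ℕ f ≡ 0 → ∀ i → f i ≡ 0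
  ∑ℕ-zero (suc n) f e zero = m+n≡0⇒m≡0 (f zero) e
  ∑ℕ-zero (suc n) f e (suc i) = ∑ℕ-zero n (f ∘ suc) (m+n≡0⇒n≡0 (f zero) e) i

  ∑ℕ-except : ∀ n (f : Fin n → ℕ) (j₀ : Fin n) c → (∀ l → l ≢ j₀ → f l ≡ c) → ∑ℕ f + c ≡ f j₀ + n * c
  ∑ℕ-except (suc n) f zero c const = begin
    f zero + ∑ℕ (f ∘ suc) + c ≡⟨ +-assoc (f zero) _ c ⟩
    f zero + (∑ℕ (f ∘ suc) + c) ≡⟨ cong (λ s → f zero + (s + c)) rest ⟩
    f zero + (n * c + c) ≡⟨ cong (f zero +_) (+-comm (n * c) c) ⟩
    f zero + suc n * c ∎
    where
    open ≡-Reasoning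
    rest : ∑ℕ (f ∘ suc) ≡ n * c
    rest = trans (∑ℕ-cong n (λ l → const (suc l) (λ ()))) (∑ℕ-const n c)
  ∑ℕ-except (suc n) f (suc j) c const = begin
    f zero + ∑ℕ (f ∘ suc) + c ≡⟨ +-assoc (f zero) _ c ⟩
    f zero + (∑ℕ (f ∘ suc) + c) ≡⟨ cong₂ _+_ (const zero (λ ())) (∑ℕ-except n (f ∘ suc) j c (λ l l≢j → const (suc l) (l≢j ∘ Fin.suc-injective))) ⟩
    c + (f (suc j) + n * c) ≡⟨ +-comm c _ ⟩
    f (suc j) + n * c + c ≡⟨ +-assoc (f (suc j)) _ c ⟩
    f (suc j) + (n * c + c) ≡⟨ cong (f (suc j) +_) (+-comm (n * c) c) ⟩
    f (suc j) + suc n * c ∎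
    where open ≡-Reasoning

  ∑ℕ-unique : ∀ n {P : Fin n → Set} (d : ∀ i → Dec (P i)) → (∀ i j → P i → P j → i ≡ j)
    → (e : Dec (∃ P)) → ∑ℕ (λ i → ind (d i)) ≡ ind e
  ∑ℕ-unique zero d u e = sym (ind-no e λ ())
  ∑ℕ-unique (suc n) d u e with d zero
  ... | yes p0 = trans (cong suc rest-empty) (sym (ind-yes e (zero , p0)))
    where
    rest-empty : ∑ℕ (λ i → ind (d (suc i))) ≡ 0
    rest-empty = trans (∑ℕ-cong n (λ i → ind-no (d (suc i)) (λ pi → Fin.0≢1+n (u zero (suc i) p0 pi))))
                       (trans (∑ℕ-const n 0) (*-zeroʳ n))
  ... | no ¬p0 = trans (∑ℕ-unique n (d ∘ suc) (λ i j pi pj → Fin.suc-injective (u (suc i) (suc j) pi pj)) (Fin.any? (d ∘ suc)))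
                       (ind-⇔ _ e (λ { (i , pi) → suc i , pi }) λ { (zero , p) → ⊥-elim (¬p0 p) ; (suc i , p) → i , p })

  size-∑ℕ : ∀ n (S : Subset n) → ∣ S ∣ ≡ ∑ℕ (λ j → ind (j ∈? S))
  size-∑ℕ zero [] = refl
  size-∑ℕ (suc n) (inside ∷ S) = cong suc (trans (size-∑ℕ n S) (∑ℕ-cong n (λ j → ind-⇔ (j ∈? S) (suc j ∈? (inside ∷ S)) there (λ { (there h) → h }))))
  size-∑ℕ (suc n) (outside ∷ S) = trans (size-∑ℕ n S) (∑ℕ-cong n (λ j → ind-⇔ (j ∈? S) (suc j ∈? (outside ∷ S)) there (λ { (there h) → h })))

-- Sums over all words of length v in the alphabet Fin q.  Such words are the coordinate
-- vectors of F^v for a field F with q elements, so these sums count vectors of F^v.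
module WordSums (q : ℕ) where

  open import Data.Nat using (ℕ; zero; suc; _+_; _*_; _^_)
  open import Data.Nat.Properties using (*-assoc; *-identityʳ; *-distribˡ-+; +-identityʳ; +-cancelˡ-≡; 0≢1+n)
  open import Data.Fin using (Fin; zero; suc)
  import Data.Fin.Properties as Fin
  open import Data.Vec using (Vec; []; _∷_; insertAt)
  import Data.Vec.Properties as Vec
  open import Data.Product using (∃; _,_)
  open import Relation.Nullary using (Dec; yes; no; ¬?; _×-dec_)
  open import Relation.Nullary.Decidable using (decidable-stable)
  open import Relation.Binary.PropositionalEquality
  open Indicators

  Word : ℕ → Set
  Word v = Vec (Fin q) v

  ΣW : ∀ v → (Word v → ℕ) → ℕ
  ΣW zero f = f []
  ΣW (suc v) f = ∑ℕ (λ x → ΣW v (λ c → f (x ∷ c)))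

  ΣW-cong : ∀ v {f g : Word v → ℕ} → (∀ c → f c ≡ g c) → ΣW v f ≡ ΣW v g
  ΣW-cong zero e = e []
  ΣW-cong (suc v) e = ∑ℕ-cong q (λ x → ΣW-cong v (λ c → e (x ∷ c)))

  ΣW-+ : ∀ v (f g : Word v → ℕ) → ΣW v (λ c → f c + g c) ≡ ΣW v f + ΣW v g
  ΣW-+ zero f g = refl
  ΣW-+ (suc v) f g = trans (∑ℕ-cong q (λ x → ΣW-+ v _ _))
    (∑-distrib-+ (λ x → ΣW v (λ c → f (x ∷ c))) (λ x → ΣW v (λ c → g (x ∷ c))))

  ΣW-const : ∀ v c → ΣW v (λ _ → c) ≡ q ^ v * c
  ΣW-const zero c = sym (+-identityʳ c)
  ΣW-const (suc v) c = trans (∑ℕ-cong q (λ x → ΣW-const v c))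
    (trans (∑ℕ-const q (q ^ v * c)) (sym (*-assoc q (q ^ v) c)))

  ΣW-*ˡ : ∀ v k (f : Word v → ℕ) → k * ΣW v f ≡ ΣW v (λ c → k * f c)
  ΣW-*ˡ zero k f = refl
  ΣW-*ˡ (suc v) k f = trans (*-distribˡ-sum k (λ x → ΣW v (λ c → f (x ∷ c)))) (∑ℕ-cong q (λ x → ΣW-*ˡ v k _))

  ΣW-zero : ∀ v (f : Word v → ℕ) → ΣW v f ≡ 0 → ∀ c → f c ≡ 0
  ΣW-zero zero f e [] = e
  ΣW-zero (suc v) f e (x ∷ c) = ΣW-zero v _ (∑ℕ-zero q _ e x) c

  ΣW-full : ∀ v {P Q : Word v → Set} (P? : ∀ c → Dec (P c)) (Q? : ∀ c → Dec (Q c)) →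
    ΣW v (λ c → ind (P? c ×-dec Q? c)) ≡ ΣW v (λ c → ind (P? c)) → ∀ c → P c → Q c
  ΣW-full v P? Q? same c p = decidable-stable (Q? c) λ ¬q →
    0≢1+n (trans (sym (ΣW-zero v _ no-counterexample c)) (ind-yes (P? c ×-dec ¬? (Q? c)) (p , ¬q)))
    where
    split : ∀ c → ind (P? c) ≡ ind (P? c ×-dec Q? c) + ind (P? c ×-dec ¬? (Q? c))
    split c = begin
      ind (P? c) ≡⟨ sym (*-identityʳ _) ⟩
      ind (P? c) * 1 ≡⟨ cong (ind (P? c) *_) (sym (ind-¬ (Q? c))) ⟩
      ind (P? c) * (ind (Q? c) + ind (¬? (Q? c))) ≡⟨ *-distribˡ-+ (ind (P? c)) _ _ ⟩
      ind (P? c) * ind (Q? c) + ind (P? c) * ind (¬? (Q? c)) ≡⟨ sym (cong₂ _+_ (ind-× (P? c) (Q? c)) (ind-× (P? c) (¬? (Q? c)))) ⟩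
      ind (P? c ×-dec Q? c) + ind (P? c ×-dec ¬? (Q? c)) ∎
      where open ≡-Reasoning
    no-counterexample : ΣW v (λ c → ind (P? c ×-dec ¬? (Q? c))) ≡ 0
    no-counterexample = +-cancelˡ-≡ (ΣW v (λ c → ind (P? c ×-dec Q? c))) _ 0
      (trans (sym (ΣW-+ v _ _)) (trans (sym (ΣW-cong v split)) (trans (sym same) (sym (+-identityʳ _)))))

  ΣW-∑ℕ : ∀ v n (f : Word v → Fin n → ℕ) → ΣW v (λ c → ∑ℕ (f c)) ≡ ∑ℕ (λ j → ΣW v (λ c → f c j))
  ΣW-∑ℕ zero n f = refl
  ΣW-∑ℕ (suc v) n f = trans (∑ℕ-cong q (λ x → ΣW-∑ℕ v n _)) (∑-comm (λ x j → ΣW v (λ c → f (x ∷ c) j)))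

  ΣW-ΣW : ∀ v w (f : Word v → Word w → ℕ) → ΣW v (λ c → ΣW w (f c)) ≡ ΣW w (λ d → ΣW v (λ c → f c d))
  ΣW-ΣW zero w f = refl
  ΣW-ΣW (suc v) w f = trans (∑ℕ-cong q (λ x → ΣW-ΣW v w _)) (sym (ΣW-∑ℕ w q (λ d x → ΣW v (λ c → f (x ∷ c) d))))

  any-word? : ∀ v {P : Word v → Set} → (∀ c → Dec (P c)) → Dec (∃ P)
  any-word? zero d with d []
  ... | yes p = yes ([] , p)
  ... | no ¬p = no λ { ([] , p) → ¬p p }
  any-word? (suc v) {P} d with Fin.any? (λ x → any-word? v (λ c → d (x ∷ c)))
  ... | yes (x , c , p) = yes (x ∷ c , p)
  ... | no ¬p = no λ { (x ∷ c , p) → ¬p (x , c , p) }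

  ΣW-unique : ∀ v {P : Word v → Set} (d : ∀ c → Dec (P c)) → (∀ c c' → P c → P c' → c ≡ c')
    → (e : Dec (∃ P)) → ΣW v (λ c → ind (d c)) ≡ ind e
  ΣW-unique zero d u e = ind-⇔ (d []) e (λ p → [] , p) λ { ([] , p) → p }
  ΣW-unique (suc v) d u e =
    trans (∑ℕ-cong q (λ x → ΣW-unique v (d-at x) (λ c c' p p' → Vec.∷-injectiveʳ (u _ _ p p')) (any-word? v (d-at x))))
    (trans (∑ℕ-unique q (λ x → any-word? v (d-at x)) (λ { x y (c , p) (c' , p') → Vec.∷-injectiveˡ (u _ _ p p') })
                         (Fin.any? (λ x → any-word? v (d-at x))))
           (ind-⇔ _ e (λ { (x , c , p) → x ∷ c , p }) λ { (x ∷ c , p) → x , c , p }))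
    where
    d-at = λ x c → d (x ∷ c)

  ΣW-insert : ∀ v (p : Fin (suc v)) (f : Word (suc v) → ℕ) →
    ΣW (suc v) f ≡ ΣW v (λ c → ∑ℕ (λ x → f (insertAt c p x)))
  ΣW-insert v zero f = sym (ΣW-∑ℕ v q (λ c x → f (x ∷ c)))
  ΣW-insert (suc v) (suc p) f = ∑ℕ-cong q (λ y → ΣW-insert v p (λ c → f (y ∷ c)))

module FiniteField (R : CommutativeRing 0ℓ 0ℓ) (isField : IsField R) (q : ℕ) (size : HasSize R q) where

  open CommutativeRing R hiding (zero)
  open IsField isField
  open HasSize size
  open Linear R
  open import Algebra.Properties.Semiring.Sum semiring
  open import Relation.Binary.Reasoning.Setoid setoid
  open import Algebra.Solver.Ring.NaturalCoefficients.Default commutativeSemiring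
  open import Algebra.Properties.Ring ring using (-‿distribˡ-*; -1*x≈-x; [y-z]x≈yx-zx)
  open import Algebra.Properties.Group +-group using (inverseˡ-unique; ε⁻¹≈ε; x∙y⁻¹≈ε⇒x≈y)
  open import Algebra.Properties.AbelianGroup +-abelianGroup using (⁻¹-∙-comm)
  import Data.Nat as ℕ
  import Data.Nat.Properties as ℕP
  open import Data.Nat using (suc; zero; z≤n; s≤s)
  open import Data.Fin using (Fin; zero; suc; punchIn; punchOut)
  import Data.Fin as F
  import Data.Fin.Properties as FP
  open import Data.Fin using (_↑ˡ_; _↑ʳ_)
  open import Data.Vec using (lookup; tabulate; insertAt)
  open import Data.Vec.Functional using (_++_)
  open import Data.Vec.Functional.Properties using (lookup-++ˡ; lookup-++ʳ)
  import Data.Vec.Properties as VP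
  open import Data.Product using (∃-syntax; _×_; _,_; proj₁; proj₂)
  open import Data.Sum using (_⊎_; inj₁; inj₂)
  open import Data.Empty using (⊥-elim)
  open import Relation.Nullary using (¬_; Dec; yes; no; ¬?; _×-dec_)
  open import Relation.Nullary.Decidable using (decidable-stable)
  open import Relation.Binary.PropositionalEquality as ≡ using (_≡_; _≢_)
  open import Function using (_∘_)
  open Indicators using (∑ℕ; ind; ind-⇔; ind-yes; ∑ℕ-cong; ∑ℕ-unique)
  open WordSums q

  code : Carrier → Fin q
  code x = proj₁ (surj x)

  code-spec : ∀ x → enum (code x) ≈ x
  code-spec x = proj₂ (surj x)

  code-cong : ∀ {x y} → x ≈ y → code x ≡ code y
  code-cong {x} {y} e = inj (code x) (code y) (trans (code-spec x) (trans e (sym (code-spec y))))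

  infix 4 _≟_
  _≟_ : ∀ x y → Dec (x ≈ y)
  x ≟ y with code x F.≟ code y
  ... | yes e = yes (trans (sym (code-spec x)) (trans (reflexive (≡.cong enum e)) (code-spec y)))
  ... | no ne = no λ e → ne (code-cong e)

  2≤q : 2 ℕ.≤ q
  2≤q = enumerates-two q enum surj
    where
    enumerates-two : ∀ n (en : Fin n → Carrier) → (∀ x → ∃[ i ] (en i ≈ x)) → 2 ℕ.≤ n
    enumerates-two zero en su with su 0#
    ... | () , _
    enumerates-two (suc zero) en su with su 1# | su 0#
    ... | zero , e1 | zero , e0 = ⊥-elim (1≉0 (trans (sym e1) e0))
    enumerates-two (suc (suc n)) en su = s≤s (s≤s z≤n)

  -- Vectors of F^v correspond to words of length v: every vector is ≈ᵥ to exactly one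
  -- vec c, so counting words counts vectors.
  vec : ∀ {v} → Word v → Vect v
  vec c i = enum (lookup c i)

  word : ∀ {v} → Vect v → Word v
  word x = tabulate (code ∘ x)

  vec-word : ∀ {v} (x : Vect v) → vec (word x) ≈ᵥ x
  vec-word x i = trans (reflexive (≡.cong enum (VP.lookup∘tabulate (code ∘ x) i))) (code-spec (x i))

  vec-injective : ∀ {v} (c c' : Word v) → vec c ≈ᵥ vec c' → c ≡ c'
  vec-injective c c' e = ≡.trans (≡.sym (VP.tabulate∘lookup c))
    (≡.trans (VP.tabulate-cong (λ i → inj _ _ (e i))) (VP.tabulate∘lookup c'))

  ≈ᵥ-refl : ∀ {v} {x : Vect v} → x ≈ᵥ x
  ≈ᵥ-refl i = refl

  ≈ᵥ-sym : ∀ {v} {x y : Vect v} → x ≈ᵥ y → y ≈ᵥ x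
  ≈ᵥ-sym e i = sym (e i)

  ≈ᵥ-trans : ∀ {v} {x y z : Vect v} → x ≈ᵥ y → y ≈ᵥ z → x ≈ᵥ z
  ≈ᵥ-trans e f i = trans (e i) (f i)

  _≟ᵥ_ : ∀ {v} (x y : Vect v) → Dec (x ≈ᵥ y)
  x ≟ᵥ y = FP.all? (λ i → x i ≟ y i)

  vsum-coord : ∀ {m v} (f : Fin m → Vect v) i → vsum f i ≈ sum (λ j → f j i)
  vsum-coord {zero} f i = refl
  vsum-coord {suc m} f i = +-congˡ (vsum-coord (f ∘ suc) i)

  lincomb-coord : ∀ {m v} (c : Fin m → Carrier) (b : Fin m → Vect v) i →
    lincomb c b i ≈ sum (λ j → c j * b j i)
  lincomb-coord c b i = vsum-coord (λ j → c j · b j) i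

  sum-cong : ∀ {n} {f g : Fin n → Carrier} → (∀ i → f i ≈ g i) → sum f ≈ sum g
  sum-cong e = sum-cong-≋ e

  sum-0 : ∀ {n} {f : Fin n → Carrier} → (∀ i → f i ≈ 0#) → sum f ≈ 0#
  sum-0 {n} e = trans (sum-cong e) (sum-replicate-zero n)

  sum-neg : ∀ {n} (f : Fin n → Carrier) → sum (λ m → - f m) ≈ - sum f
  sum-neg {zero} f = sym ε⁻¹≈ε
  sum-neg {suc n} f = trans (+-congˡ (sum-neg (f ∘ suc))) (⁻¹-∙-comm (f zero) (sum (f ∘ suc)))

  sum-split : ∀ {n} (p : Fin (suc n)) (f : Fin (suc n) → Carrier) → sum f ≈ f p + sum (f ∘ punchIn p)
  sum-split p f = sum-remove {i = p} f

  split-fin : ∀ {n} (p j : Fin (suc n)) → j ≡ p ⊎ ∃[ m ] (j ≡ punchIn p m)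
  split-fin p j with j F.≟ p
  ... | yes e = inj₁ e
  ... | no ne = inj₂ (punchOut (λ e → ne (≡.sym e)) , ≡.sym (FP.punchIn-punchOut (λ e → ne (≡.sym e))))

  δ : ∀ {n} → Fin n → Fin n → Carrier
  δ i j with i F.≟ j
  ... | yes _ = 1#
  ... | no _ = 0#

  δ-refl : ∀ {n} (i : Fin n) → δ i i ≈ 1#
  δ-refl i with i F.≟ i
  ... | yes _ = refl
  ... | no ne = ⊥-elim (ne ≡.refl)

  δ-ne : ∀ {n} (i j : Fin n) → i ≢ j → δ i j ≈ 0#
  δ-ne i j ne with i F.≟ j
  ... | yes e = ⊥-elim (ne e)
  ... | no _ = refl

  δ-sym : ∀ {n} (i j : Fin n) → δ i j ≈ δ j i
  δ-sym i j with i F.≟ j | j F.≟ i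
  ... | yes _ | yes _ = refl
  ... | no _ | no _ = refl
  ... | yes e | no ne = ⊥-elim (ne (≡.sym e))
  ... | no ne | yes e = ⊥-elim (ne (≡.sym e))

  δ-punchIn : ∀ {n} (p : Fin (suc n)) (m m' : Fin n) → δ (punchIn p m') (punchIn p m) ≈ δ m' m
  δ-punchIn p m m' with punchIn p m' F.≟ punchIn p m | m' F.≟ m
  ... | yes _ | yes _ = refl
  ... | no _ | no _ = refl
  ... | yes e | no ne = ⊥-elim (ne (FP.punchIn-injective p m' m e))
  ... | no ne | yes e = ⊥-elim (ne (≡.cong (punchIn p) e))

  sum-δ : ∀ {n} (i : Fin n) (f : Fin n → Carrier) → sum (λ j → δ i j * f j) ≈ f i
  sum-δ {suc n} i f = begin
    sum (λ j → δ i j * f j) ≈⟨ sum-split i (λ j → δ i j * f j) ⟩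
    δ i i * f i + sum (λ j → δ i (punchIn i j) * f (punchIn i j))
      ≈⟨ +-cong (*-congʳ (δ-refl i)) (sum-0 (λ j → trans (*-congʳ (δ-ne i _ (λ e → FP.punchInᵢ≢i i j (≡.sym e)))) (zeroˡ _))) ⟩
    1# * f i + 0# ≈⟨ trans (+-identityʳ _) (*-identityˡ _) ⟩
    f i ∎

  sum-δ' : ∀ {n} (i : Fin n) (f : Fin n → Carrier) → sum (λ j → f j * δ j i) ≈ f i
  sum-δ' i f = trans (sum-cong (λ j → trans (*-comm _ _) (*-congʳ (δ-sym j i)))) (sum-δ i f)

  lincomb-δ : ∀ {m v} (j : Fin m) (b : Fin m → Vect v) → lincomb (δ j) b ≈ᵥ b j
  lincomb-δ j b i = trans (lincomb-coord (δ j) b i) (sum-δ j (λ k → b k i))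

  indep-head-nonzero : ∀ {d v} (b : Fin (suc d) → Vect v) → LinIndep b → ¬ (b zero ≈ᵥ 0ᵥ)
  indep-head-nonzero {d} b li e = 1≉0 (trans (sym (δ-refl {suc d} zero)) (li (δ zero) (≈ᵥ-trans (lincomb-δ zero b) e) zero))

  dot : ∀ {v} → Vect v → Vect v → Carrier
  dot a x = sum (λ i → a i * x i)

  dot-cong : ∀ {v} {a a' x x' : Vect v} → a ≈ᵥ a' → x ≈ᵥ x' → dot a x ≈ dot a' x'
  dot-cong ea ex = sum-cong (λ i → *-cong (ea i) (ex i))

  dot-zeroˡ : ∀ {v} {a : Vect v} (x : Vect v) → a ≈ᵥ 0ᵥ → dot a x ≈ 0#
  dot-zeroˡ x z = trans (dot-cong z ≈ᵥ-refl) (sum-0 (λ i → zeroˡ (x i)))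

  dot-split : ∀ {v} (p : Fin (suc v)) (a x : Vect (suc v)) → dot a x ≈ a p * x p + dot (a ∘ punchIn p) (x ∘ punchIn p)
  dot-split p a x = sum-split p (λ i → a i * x i)

  dot-δ : ∀ {v} (a : Vect v) i → dot a (δ i) ≈ a i
  dot-δ a i = trans (sum-cong (λ j → *-comm (a j) (δ i j))) (sum-δ i a)

  dot-+ : ∀ {v} (a x y : Vect v) → dot a (x +ᵥ y) ≈ dot a x + dot a y
  dot-+ a x y = trans (sum-cong (λ j → distribˡ (a j) (x j) (y j))) (∑-distrib-+ (λ j → a j * x j) (λ j → a j * y j))

  dot-· : ∀ {v} (a : Vect v) s (x : Vect v) → dot a (s · x) ≈ s * dot a x
  dot-· a s x = trans (sum-cong (λ j → e (a j) s (x j))) (sym (*-distribˡ-sum s (λ j → a j * x j)))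
    where
    e : ∀ a s x → a * (s * x) ≈ s * (a * x)
    e = solve 3 (λ a s x → (a :* (s :* x)) := (s :* (a :* x))) refl

  dot-axpy : ∀ {v} (a x y : Vect v) (l : Carrier) → dot a (λ j → x j + l * y j) ≈ dot a x + l * dot a y
  dot-axpy a x y l = trans (dot-+ a x (l · y)) (+-congˡ (dot-· a l y))

  dot-lincomb : ∀ {m v} (a : Vect v) (c : Fin m → Carrier) (b : Fin m → Vect v) →
    dot a (lincomb c b) ≈ sum (λ j → c j * dot a (b j))
  dot-lincomb {m} {v} a c b = begin
    sum (λ i → a i * lincomb c b i) ≈⟨ sum-cong (λ i → *-congˡ (lincomb-coord c b i)) ⟩
    sum (λ i → a i * sum (λ j → c j * b j i)) ≈⟨ sum-cong (λ i → *-distribˡ-sum (a i) (λ j → c j * b j i)) ⟩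
    sum (λ i → sum (λ j → a i * (c j * b j i))) ≈⟨ ∑-comm (λ i j → a i * (c j * b j i)) ⟩
    sum (λ j → sum (λ i → a i * (c j * b j i))) ≈⟨ sum-cong (λ j → sum-cong (λ i → swap (a i) (c j) (b j i))) ⟩
    sum (λ j → sum (λ i → c j * (a i * b j i))) ≈⟨ sum-cong (λ j → sym (*-distribˡ-sum (c j) (λ i → a i * b j i))) ⟩
    sum (λ j → c j * dot a (b j)) ∎
    where
    swap : ∀ x y z → x * (y * z) ≈ y * (x * z)
    swap = solve 3 (λ x y z → (x :* (y :* z)) := (y :* (x :* z))) refl

  dot-lincomb-0 : ∀ {m v} (a : Vect v) (c : Fin m → Carrier) (b : Fin m → Vect v) →
    (∀ j → dot a (b j) ≈ 0#) → dot a (lincomb c b) ≈ 0#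
  dot-lincomb-0 a c b h = trans (dot-lincomb a c b) (sum-0 (λ j → trans (*-congˡ (h j)) (zeroʳ (c j))))

  affine-root : ∀ y β β⁻ t → β * β⁻ ≈ 1# → y * β + t ≈ 0# → y ≈ (- t) * β⁻
  affine-root y β β⁻ t inv e = begin
    y ≈⟨ sym (*-identityʳ y) ⟩
    y * 1# ≈⟨ *-congˡ (sym inv) ⟩
    y * (β * β⁻) ≈⟨ sym (*-assoc y β β⁻) ⟩
    (y * β) * β⁻ ≈⟨ *-congʳ (inverseˡ-unique (y * β) t e) ⟩
    (- t) * β⁻ ∎

  affine-root⁻¹ : ∀ y β β⁻ t → β * β⁻ ≈ 1# → y ≈ (- t) * β⁻ → y * β + t ≈ 0#
  affine-root⁻¹ y β β⁻ t inv e = begin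
    y * β + t ≈⟨ +-congʳ (*-congʳ e) ⟩
    (- t) * β⁻ * β + t ≈⟨ +-congʳ (reassoc (- t) β β⁻) ⟩
    (- t) * (β * β⁻) + t ≈⟨ +-congʳ (*-congˡ inv) ⟩
    (- t) * 1# + t ≈⟨ trans (+-congʳ (*-identityʳ _)) (-‿inverseˡ t) ⟩
    0# ∎
    where
    reassoc : ∀ u β β⁻ → u * β⁻ * β ≈ u * (β * β⁻)
    reassoc = solve 3 (λ u β β⁻ → (u :* β⁻ :* β) := (u :* (β :* β⁻))) refl

  eliminate : ∀ x β β⁻ → β * β⁻ ≈ 1# → x + (- (x * β⁻)) * β ≈ 0#
  eliminate x β β⁻ inv = begin
    x + (- (x * β⁻)) * β ≈⟨ +-congˡ (sym (-‿distribˡ-* (x * β⁻) β)) ⟩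
    x + (- (x * β⁻ * β)) ≈⟨ +-congˡ (-‿cong (trans (*-assoc x β⁻ β) (*-congˡ (trans (*-comm β⁻ β) inv)))) ⟩
    x + (- (x * 1#)) ≈⟨ +-congˡ (-‿cong (*-identityʳ x)) ⟩
    x + (- x) ≈⟨ -‿inverseʳ x ⟩
    0# ∎

  Ker : ∀ {v} → Vect v → Vect v → Set
  Ker a x = dot a x ≈ 0#

  Ker-subspace : ∀ {v} (a : Vect v) → IsSubspace (Ker a)
  Ker-subspace a = record
    { resp = λ e h → trans (sym (dot-cong ≈ᵥ-refl e)) h
    ; has0 = sum-0 (λ j → zeroʳ (a j))
    ; add = λ hx hy → trans (dot-+ a _ _) (trans (+-cong hx hy) (+-identityʳ 0#))
    ; scale = λ s hx → trans (dot-· a s _) (trans (*-congˡ hx) (zeroʳ s))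
    }

  module KernelBasis {v} (a : Vect (suc v)) (p : Fin (suc v)) (ne : ¬ (a p ≈ 0#)) where
    α⁻ = proj₁ (inverse (a p) ne)
    inv : a p * α⁻ ≈ 1#
    inv = proj₂ (inverse (a p) ne)

    basis : Fin v → Vect (suc v)
    basis m j = δ (punchIn p m) j + (- (a (punchIn p m) * α⁻)) * δ p j

    coord-punchIn : ∀ (c : Fin v → Carrier) m → lincomb c basis (punchIn p m) ≈ c m
    coord-punchIn c m = trans (lincomb-coord c basis (punchIn p m))
      (trans (sum-cong (λ m' → *-congˡ (trans (+-cong (δ-punchIn p m m') (trans (*-congˡ (δ-ne p (punchIn p m) (λ e → FP.punchInᵢ≢i p m (≡.sym e)))) (zeroʳ _))) (+-identityʳ _))))
             (sum-δ' m c))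

    independent : LinIndep basis
    independent c z m = trans (sym (coord-punchIn c m)) (z (punchIn p m))

    basis-in-Ker : ∀ m → Ker a (basis m)
    basis-in-Ker m = trans (dot-axpy a (δ (punchIn p m)) (δ p) _)
      (trans (+-cong (dot-δ a (punchIn p m)) (*-congˡ (dot-δ a p))) (eliminate (a (punchIn p m)) (a p) α⁻ inv))

    -- At p, a kernel vector is determined by its other coordinates, like the combination.
    coord-p : ∀ (x : Vect (suc v)) → Ker a x → lincomb (x ∘ punchIn p) basis p ≈ x p
    coord-p x h = begin
      lincomb (x ∘ punchIn p) basis p ≈⟨ lincomb-coord (x ∘ punchIn p) basis p ⟩
      sum (λ m → x (punchIn p m) * basis m p)
        ≈⟨ sum-cong (λ m → *-congˡ (trans (+-cong (δ-ne (punchIn p m) p (FP.punchInᵢ≢i p m)) (trans (*-congˡ (δ-refl p)) (*-identityʳ _))) (+-identityˡ _))) ⟩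
      sum (λ m → x (punchIn p m) * (- (a (punchIn p m) * α⁻)))
        ≈⟨ sum-cong (λ m → trans (*-congˡ (-‿distribˡ-* (a (punchIn p m)) α⁻)) (regroup (x (punchIn p m)) (a (punchIn p m)) α⁻)) ⟩
      sum (λ m → (- (a (punchIn p m) * x (punchIn p m))) * α⁻)
        ≈⟨ sym (*-distribʳ-sum α⁻ (λ m → - (a (punchIn p m) * x (punchIn p m)))) ⟩
      sum (λ m → - (a (punchIn p m) * x (punchIn p m))) * α⁻ ≈⟨ *-congʳ (sum-neg (λ m → a (punchIn p m) * x (punchIn p m))) ⟩
      (- t) * α⁻ ≈⟨ sym (affine-root (x p) (a p) α⁻ t inv (trans (+-congʳ (*-comm (x p) (a p))) (trans (sym (dot-split p a x)) h))) ⟩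
      x p ∎
      where
      t = dot (a ∘ punchIn p) (x ∘ punchIn p)
      regroup : ∀ x a b → x * ((- a) * b) ≈ (- (a * x)) * b
      regroup x a b = trans (sym (*-assoc x (- a) b)) (*-congʳ (trans (*-comm x (- a)) (sym (-‿distribˡ-* a x))))

    is-basis : IsBasis (Ker a) basis
    is-basis = independent , λ x →
      (λ h → (x ∘ punchIn p) , λ j → sym (coords x h j)) ,
      (λ { (c , e) → trans (dot-cong (≈ᵥ-refl {x = a}) e) (dot-lincomb-0 a c basis basis-in-Ker) })
      where
      coords : ∀ x → Ker a x → ∀ j → lincomb (x ∘ punchIn p) basis j ≈ x j
      coords x h j with split-fin p j
      ... | inj₁ ≡.refl = coord-p x h
      ... | inj₂ (m , ≡.refl) = coord-punchIn (x ∘ punchIn p) m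

  nonzero-coordinate : ∀ {v} (a : Vect v) → ¬ (a ≈ᵥ 0ᵥ) → ∃[ p ] ¬ (a p ≈ 0#)
  nonzero-coordinate a nz with FP.any? (λ p → ¬? (a p ≟ 0#))
  ... | yes found = found
  ... | no none = ⊥-elim (nz (λ p → decidable-stable (a p ≟ 0#) (λ ne → none (p , ne))))

  kernel-hyperplane : ∀ {v} (a : Vect v) → ¬ (a ≈ᵥ 0ᵥ) → IsHyperplane (Ker a)
  kernel-hyperplane {zero} a nz = ⊥-elim (nz (λ ()))
  kernel-hyperplane {suc v} a nz = let (p , ne) = nonzero-coordinate a nz in
    Ker-subspace a , KernelBasis.basis a p ne , KernelBasis.is-basis a p ne

  ⊆Ker⇔ : ∀ {k v} (N : Vect v → Set) (B : Fin k → Vect v) → IsBasis N B → (a : Vect v) →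
    (N ⊆ Ker a → ∀ i → dot a (B i) ≈ 0#) × ((∀ i → dot a (B i) ≈ 0#) → N ⊆ Ker a)
  ⊆Ker⇔ N B (li , sp) a =
    (λ s i → s (B i) (proj₂ (sp (B i)) (δ i , ≈ᵥ-sym (lincomb-δ i B)))) ,
    (λ h x nx → let (c , e) = proj₁ (sp x) nx in trans (dot-cong ≈ᵥ-refl e) (dot-lincomb-0 a c B h))

  Ann : ∀ {d v} → (Fin d → Vect v) → Word v → Set
  Ann b c = ∀ i → dot (vec c) (b i) ≈ 0#

  Ann? : ∀ {d v} (b : Fin d → Vect v) c → Dec (Ann b c)
  Ann? b c = FP.all? (λ i → dot (vec c) (b i) ≟ 0#)

  -- Let b₀,…,b_d in F^(v+1) be independent with
  -- (b₀)_p = β ≠ 0.  Clearing coordinate p of b₁,…,b_d with b₀ and then deleting it gives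
  -- an independent family `reduced` of d vectors in F^v, and for every word c' of length v
  -- the words c' with one letter inserted at p that annihilate b are: exactly one if c'
  -- annihilates `reduced`, none otherwise.
  module Elimination {d v} (b : Fin (suc d) → Vect (suc v)) (li : LinIndep b)
                     (p : Fin (suc v)) (ne : ¬ (b zero p ≈ 0#)) where
    β = b zero p
    β⁻ = proj₁ (inverse β ne)
    inv : β * β⁻ ≈ 1#
    inv = proj₂ (inverse β ne)

    μ : Fin d → Carrier
    μ i = b (suc i) p * β⁻

    cleared : Fin d → Vect (suc v)
    cleared i j = b (suc i) j + (- μ i) * b zero j

    cleared-p : ∀ i → cleared i p ≈ 0#
    cleared-p i = eliminate (b (suc i) p) β β⁻ inv

    reduced : Fin d → Vect v
    reduced i m = cleared i (punchIn p m)

    b₀-reduced : Vect v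
    b₀-reduced m = b zero (punchIn p m)

    lift : (Fin d → Carrier) → Fin (suc d) → Carrier
    lift c zero = sum (λ i → c i * (- μ i))
    lift c (suc i) = c i

    lincomb-lift : ∀ c j → lincomb (lift c) b j ≈ sum (λ i → c i * cleared i j)
    lincomb-lift c j = begin
      lincomb (lift c) b j ≈⟨ lincomb-coord (lift c) b j ⟩
      lift c zero * b zero j + sum (λ i → c i * b (suc i) j) ≈⟨ +-comm _ _ ⟩
      sum (λ i → c i * b (suc i) j) + lift c zero * b zero j
        ≈⟨ +-congˡ (*-distribʳ-sum (b zero j) (λ i → c i * (- μ i))) ⟩
      sum (λ i → c i * b (suc i) j) + sum (λ i → c i * (- μ i) * b zero j)
        ≈⟨ sym (∑-distrib-+ (λ i → c i * b (suc i) j) (λ i → c i * (- μ i) * b zero j)) ⟩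
      sum (λ i → c i * b (suc i) j + c i * (- μ i) * b zero j) ≈⟨ sum-cong (λ i → sym (expand (c i) (b (suc i) j) (- μ i) (b zero j))) ⟩
      sum (λ i → c i * cleared i j) ∎
      where
      expand : ∀ c x l y → c * (x + l * y) ≈ c * x + c * l * y
      expand = solve 4 (λ c x l y → (c :* (x :+ l :* y)) := (c :* x :+ c :* l :* y)) refl

    reduced-independent : LinIndep reduced
    reduced-independent c z i = li (lift c) lifted-zero (suc i)
      where
      lifted-zero : lincomb (lift c) b ≈ᵥ 0ᵥ
      lifted-zero j with split-fin p j
      ... | inj₁ ≡.refl = trans (lincomb-lift c p) (sum-0 (λ i → trans (*-congˡ (cleared-p i)) (zeroʳ (c i))))
      ... | inj₂ (m , ≡.refl) = trans (lincomb-lift c (punchIn p m)) (trans (sym (lincomb-coord c reduced m)) (z m))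

    -- the part of a·b₀ coming from the coordinates other than p
    rest : Word v → Carrier
    rest c' = dot (vec c') b₀-reduced

    module _ (c' : Word v) (x : Fin q) where
      a = vec (insertAt c' p x)

      a-punchIn : ∀ m → a (punchIn p m) ≈ vec c' m
      a-punchIn m = reflexive (≡.cong enum (VP.insertAt-punchIn c' p x m))

      a·b₀ : dot a (b zero) ≈ enum x * β + rest c'
      a·b₀ = trans (dot-split p a (b zero)) (+-cong (*-congʳ a-p) (dot-cong a-punchIn (λ _ → refl)))
        where
        a-p : a p ≈ enum x
        a-p = reflexive (≡.cong enum (VP.insertAt-lookup c' p x))

      a·cleared : ∀ i → dot a (cleared i) ≈ dot (vec c') (reduced i)
      a·cleared i = trans (dot-split p a (cleared i))
        (trans (+-cong (trans (*-congˡ (cleared-p i)) (zeroʳ _)) (dot-cong a-punchIn (λ _ → refl))) (+-identityˡ _))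

      a·cleared' : ∀ i → dot a (cleared i) ≈ dot a (b (suc i)) + (- μ i) * dot a (b zero)
      a·cleared' i = dot-axpy a (b (suc i)) (b zero) (- μ i)

    -- the letter that must be inserted at p
    root : Word v → Fin q
    root c' = code ((- rest c') * β⁻)

    plus-zero : ∀ y l → y + l * 0# ≈ y
    plus-zero y l = trans (+-congˡ (zeroʳ l)) (+-identityʳ y)

    annihilates : ∀ c' x → Ann b (insertAt c' p x) → x ≡ root c' × Ann reduced c'
    annihilates c' x h =
      inj x (root c') (trans (affine-root (enum x) β β⁻ (rest c') inv (trans (sym (a·b₀ c' x)) (h zero))) (sym (code-spec _))) ,
      λ i → trans (sym (a·cleared c' x i)) (trans (a·cleared' c' x i) (trans (+-cong (h (suc i)) (*-congˡ (h zero))) (plus-zero 0# _)))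

    annihilates⁻¹ : ∀ c' → Ann reduced c' → Ann b (insertAt c' p (root c'))
    annihilates⁻¹ c' h zero = a·b₀-zero
      where
      a·b₀-zero = trans (a·b₀ c' (root c')) (affine-root⁻¹ (enum (root c')) β β⁻ (rest c') inv (code-spec _))
    annihilates⁻¹ c' h (suc i) = begin
      dot a' (b (suc i)) ≈⟨ sym (plus-zero _ (- μ i)) ⟩
      dot a' (b (suc i)) + (- μ i) * 0# ≈⟨ +-congˡ (*-congˡ (sym (annihilates⁻¹ c' h zero))) ⟩
      dot a' (b (suc i)) + (- μ i) * dot a' (b zero) ≈⟨ sym (a·cleared' c' (root c') i) ⟩
      dot a' (cleared i) ≈⟨ a·cleared c' (root c') i ⟩
      dot (vec c') (reduced i) ≈⟨ h i ⟩
      0# ∎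
      where
      a' = a c' (root c')

    fibre : ∀ c' → ∑ℕ (λ x → ind (Ann? b (insertAt c' p x))) ≡ ind (Ann? reduced c')
    fibre c' =
      ≡.trans (∑ℕ-cong q (λ x → ind-⇔ _ (is-root? x) (annihilates c' x) fill))
      (≡.trans (∑ℕ-unique q is-root? (λ { x y (e1 , _) (e2 , _) → ≡.trans e1 (≡.sym e2) }) (FP.any? is-root?))
               (ind-⇔ _ (Ann? reduced c') (λ { (_ , _ , h) → h }) (λ h → root c' , ≡.refl , h)))
      where
      is-root? : ∀ x → Dec (x ≡ root c' × Ann reduced c')
      is-root? x = x F.≟ root c' ×-dec Ann? reduced c'
      fill : ∀ {x} → x ≡ root c' × Ann reduced c' → Ann b (insertAt c' p x)
      fill (≡.refl , h) = annihilates⁻¹ c' h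

  -- d independent vectors of F^v have exactly q^(v-d) common annihilators, and d ≤ v.
  -- Induction on d by Gaussian elimination, splitting the word sum at the pivot p.
  annihilator-count : ∀ d v (b : Fin d → Vect v) → LinIndep b →
    d ℕ.≤ v × ΣW v (λ c → ind (Ann? b c)) ≡ q ℕ.^ (v ℕ.∸ d)
  annihilator-count zero v b li =
    z≤n , ≡.trans (ΣW-cong v (λ c → ind-yes (Ann? b c) (λ ()))) (≡.trans (ΣW-const v 1) (ℕP.*-identityʳ _))
  annihilator-count (suc d) zero b li = ⊥-elim (indep-head-nonzero b li (λ ()))
  annihilator-count (suc d) (suc v) b li =
    s≤s (proj₁ IH) , ≡.trans (ΣW-insert v p (λ c → ind (Ann? b c))) (≡.trans (ΣW-cong v fibre) (proj₂ IH))
    where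
    pivot = nonzero-coordinate (b zero) (indep-head-nonzero b li)
    p = proj₁ pivot
    open Elimination b li p (proj₂ pivot)
    IH = annihilator-count d v reduced reduced-independent

  ++-cases : ∀ m n (i : Fin (m ℕ.+ n)) → ∃[ a ] (a ↑ˡ n ≡ i) ⊎ ∃[ b ] (m ↑ʳ b ≡ i)
  ++-cases m n i with F.splitAt m i in eq
  ... | inj₁ a = inj₁ (a , FP.splitAt⁻¹-↑ˡ eq)
  ... | inj₂ b = inj₂ (b , FP.splitAt⁻¹-↑ʳ eq)

  sum-++ : ∀ m n (f : Fin (m ℕ.+ n) → Carrier) → sum f ≈ sum (λ i → f (i ↑ˡ n)) + sum (λ j → f (m ↑ʳ j))
  sum-++ zero n f = sym (+-identityˡ _)
  sum-++ (suc m) n f = trans (+-congˡ (sum-++ m n (f ∘ suc))) (sym (+-assoc _ _ _))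

  Ann-++ : ∀ {m n v} (b₁ : Fin m → Vect v) (b₂ : Fin n → Vect v) c →
    Ann (b₁ ++ b₂) c → Ann b₁ c × Ann b₂ c
  Ann-++ {m} {n} b₁ b₂ c h =
    (λ i → trans (reflexive (≡.cong (dot (vec c)) (≡.sym (lookup-++ˡ b₁ b₂ i)))) (h (i ↑ˡ n))) ,
    (λ j → trans (reflexive (≡.cong (dot (vec c)) (≡.sym (lookup-++ʳ b₁ b₂ j)))) (h (m ↑ʳ j)))

  Ann-++⁻¹ : ∀ {m n v} (b₁ : Fin m → Vect v) (b₂ : Fin n → Vect v) c →
    Ann b₁ c → Ann b₂ c → Ann (b₁ ++ b₂) c
  Ann-++⁻¹ {m} {n} b₁ b₂ c h₁ h₂ i with ++-cases m n i
  ... | inj₁ (a , ≡.refl) = trans (reflexive (≡.cong (dot (vec c)) (lookup-++ˡ b₁ b₂ a))) (h₁ a)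
  ... | inj₂ (b , ≡.refl) = trans (reflexive (≡.cong (dot (vec c)) (lookup-++ʳ b₁ b₂ b))) (h₂ b)

  lincomb-++ : ∀ {m n v} (c : Fin (m ℕ.+ n) → Carrier) (b₁ : Fin m → Vect v) (b₂ : Fin n → Vect v) j →
    lincomb c (b₁ ++ b₂) j ≈ lincomb (c ∘ (_↑ˡ n)) b₁ j + lincomb (c ∘ (m ↑ʳ_)) b₂ j
  lincomb-++ {m} {n} c b₁ b₂ j = begin
    lincomb c (b₁ ++ b₂) j ≈⟨ lincomb-coord c (b₁ ++ b₂) j ⟩
    sum (λ i → c i * (b₁ ++ b₂) i j) ≈⟨ sum-++ m n (λ i → c i * (b₁ ++ b₂) i j) ⟩
    sum (λ i → c (i ↑ˡ n) * (b₁ ++ b₂) (i ↑ˡ n) j) + sum (λ i → c (m ↑ʳ i) * (b₁ ++ b₂) (m ↑ʳ i) j)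
      ≈⟨ +-cong (sum-cong (λ i → *-congˡ (reflexive (≡.cong (λ z → z j) (lookup-++ˡ b₁ b₂ i)))))
                (sum-cong (λ i → *-congˡ (reflexive (≡.cong (λ z → z j) (lookup-++ʳ b₁ b₂ i))))) ⟩
    sum (λ i → c (i ↑ˡ n) * b₁ i j) + sum (λ i → c (m ↑ʳ i) * b₂ i j)
      ≈⟨ sym (+-cong (lincomb-coord (c ∘ (_↑ˡ n)) b₁ j) (lincomb-coord (c ∘ (m ↑ʳ_)) b₂ j)) ⟩
    lincomb (c ∘ (_↑ˡ n)) b₁ j + lincomb (c ∘ (m ↑ʳ_)) b₂ j ∎

  indep-++ : ∀ {m n v} (N₁ N₂ : Vect v → Set) (b₁ : Fin m → Vect v) (b₂ : Fin n → Vect v) →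
    IsBasis N₁ b₁ → IsBasis N₂ b₂ → IsSubspace N₂ → (∀ x → N₁ x → N₂ x → x ≈ᵥ 0ᵥ) → LinIndep (b₁ ++ b₂)
  indep-++ {m} {n} N₁ N₂ b₁ b₂ (li₁ , sp₁) (li₂ , sp₂) sub₂ trivial c z i = by-block i (++-cases m n i)
    where
    u = lincomb (c ∘ (_↑ˡ n)) b₁
    w = lincomb (c ∘ (m ↑ʳ_)) b₂
    u+w≈0 : ∀ j → u j + w j ≈ 0#
    u+w≈0 j = trans (sym (lincomb-++ c b₁ b₂ j)) (z j)
    -- u = -w lies in N₁ ∩ N₂
    u∈N₂ : N₂ u
    u∈N₂ = IsSubspace.resp sub₂ (λ j → trans (-1*x≈-x (w j)) (sym (inverseˡ-unique (u j) (w j) (u+w≈0 j))))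
                                (IsSubspace.scale sub₂ (- 1#) (proj₂ (sp₂ w) (_ , ≈ᵥ-refl)))
    u≈0 : u ≈ᵥ 0ᵥ
    u≈0 = trivial u (proj₂ (sp₁ u) (_ , ≈ᵥ-refl)) u∈N₂
    w≈0 : w ≈ᵥ 0ᵥ
    w≈0 j = trans (sym (+-identityˡ (w j))) (trans (+-congʳ (sym (u≈0 j))) (u+w≈0 j))
    by-block : ∀ i → ∃[ a ] (a ↑ˡ n ≡ i) ⊎ ∃[ b ] (m ↑ʳ b ≡ i) → c i ≈ 0#
    by-block _ (inj₁ (a , ≡.refl)) = li₁ _ u≈0 a
    by-block _ (inj₂ (b , ≡.refl)) = li₂ _ w≈0 b

  lincomb-injective : ∀ {m v} (x y : Fin m → Carrier) (b : Fin m → Vect v) → LinIndep b →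
    lincomb x b ≈ᵥ lincomb y b → ∀ i → x i ≈ y i
  lincomb-injective x y b li e i = x∙y⁻¹≈ε⇒x≈y (x i) (y i) (li (λ i → x i - y i) difference-zero i)
    where
    difference-zero : lincomb (λ i → x i - y i) b ≈ᵥ 0ᵥ
    difference-zero j = begin
      lincomb (λ i → x i - y i) b j ≈⟨ lincomb-coord _ b j ⟩
      sum (λ i → (x i - y i) * b i j) ≈⟨ sum-cong (λ i → [y-z]x≈yx-zx (b i j) (x i) (y i)) ⟩
      sum (λ i → x i * b i j + - (y i * b i j)) ≈⟨ ∑-distrib-+ (λ i → x i * b i j) (λ i → - (y i * b i j)) ⟩
      sum (λ i → x i * b i j) + sum (λ i → - (y i * b i j))
        ≈⟨ +-cong (sym (lincomb-coord x b j)) (trans (sum-neg (λ i → y i * b i j)) (-‿cong (sym (lincomb-coord y b j)))) ⟩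
      lincomb x b j - lincomb y b j ≈⟨ +-congʳ (e j) ⟩
      lincomb y b j - lincomb y b j ≈⟨ -‿inverseʳ _ ⟩
      0# ∎

  InSpan : ∀ {k v} (B : Fin k → Vect v) → Word v → Set
  InSpan {k} B c = ∃[ d ] (vec c ≈ᵥ lincomb (vec {k} d) B)

  InSpan? : ∀ {k v} (B : Fin k → Vect v) → ∀ c → Dec (InSpan B c)
  InSpan? {k} B c = any-word? k (λ d → vec c ≟ᵥ lincomb (vec d) B)

  -- The span of k independent vectors has q^k elements: count pairs (c, d) with
  -- vec c = Σ dᵢ Bᵢ, each c having at most one d and each d exactly one c.
  span-count : ∀ {k v} (B : Fin k → Vect v) → LinIndep B → ΣW v (λ c → ind (InSpan? B c)) ≡ q ℕ.^ k
  span-count {k} {v} B li =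
    ≡.trans (ΣW-cong v (λ c → ≡.sym (ΣW-unique k (represents c) (coefficients-unique c) (InSpan? B c))))
    (≡.trans (ΣW-ΣW v k _)
    (≡.trans (ΣW-cong k (λ d → ΣW-unique v (λ c → represents c d) (vector-unique d) (yes (word (lincomb (vec d) B) , vec-word _))))
    (≡.trans (ΣW-const k 1) (ℕP.*-identityʳ _))))
    where
    represents : ∀ c d → Dec (vec c ≈ᵥ lincomb (vec d) B)
    represents c d = vec c ≟ᵥ lincomb (vec d) B
    coefficients-unique : ∀ c d d' → vec c ≈ᵥ lincomb (vec d) B → vec c ≈ᵥ lincomb (vec d') B → d ≡ d'
    coefficients-unique c d d' e e' = vec-injective d d' (lincomb-injective _ _ B li (≈ᵥ-trans (≈ᵥ-sym e) e'))
    vector-unique : ∀ d c c' → vec c ≈ᵥ lincomb (vec d) B → vec c' ≈ᵥ lincomb (vec d) B → c ≡ c'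
    vector-unique d c c' e e' = vec-injective c c' (≈ᵥ-trans e (≈ᵥ-sym e'))

  zero-in-span : ∀ {k v} (B : Fin k → Vect v) c → vec c ≈ᵥ 0ᵥ → InSpan B c
  zero-in-span {k} B c z = word 0ᵥ , λ j → trans (z j) (sym (trans (lincomb-coord _ B j) (sum-0 (λ i → trans (*-congʳ (vec-word 0ᵥ i)) (zeroˡ (B i j))))))

  nonzero? : ∀ {v} (c : Word v) → Dec (¬ (vec c ≈ᵥ 0ᵥ))
  nonzero? c = ¬? (vec c ≟ᵥ 0ᵥ)

  count-nonzero : ∀ v {P : Word v → Set} (P? : ∀ c → Dec (P c)) → (∀ c → vec c ≈ᵥ 0ᵥ → P c) →
    ΣW v (λ c → ind (nonzero? c ×-dec P? c)) ℕ.+ 1 ≡ ΣW v (λ c → ind (P? c))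
  count-nonzero v P? P0 =
    ≡.trans (≡.cong (ΣW v (λ c → ind (nonzero? c ×-dec P? c)) ℕ.+_) (≡.sym one-zero-word))
    (≡.trans (≡.sym (ΣW-+ v _ _)) (ΣW-cong v split))
    where
    one-zero-word : ΣW v (λ c → ind (vec c ≟ᵥ 0ᵥ)) ≡ 1
    one-zero-word = ΣW-unique v (λ c → vec c ≟ᵥ 0ᵥ) (λ c c' e e' → vec-injective c c' (≈ᵥ-trans e (≈ᵥ-sym e'))) (yes (word 0ᵥ , vec-word 0ᵥ))
    split : ∀ c → ind (nonzero? c ×-dec P? c) ℕ.+ ind (vec c ≟ᵥ 0ᵥ) ≡ ind (P? c)
    split c with vec c ≟ᵥ 0ᵥ
    ... | yes z = ≡.sym (ind-yes (P? c) (P0 c z))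
    ... | no nz with P? c
    ...   | yes _ = ≡.refl
    ...   | no _ = ≡.refl

  private
    pred-of : ∀ {a b} → a ℕ.+ 1 ≡ b → a ≡ b ℕ.∸ 1
    pred-of {a} e = ≡.trans (≡.sym (ℕP.m+n∸n≡m a 1)) (≡.cong (ℕ._∸ 1) e)

  nonzero-annihilator-count : ∀ {d v} (b : Fin d → Vect v) → LinIndep b →
    ΣW v (λ c → ind (nonzero? c ×-dec Ann? b c)) ≡ q ℕ.^ (v ℕ.∸ d) ℕ.∸ 1
  nonzero-annihilator-count {d} {v} b li = pred-of (≡.trans (count-nonzero v (Ann? b) zero-annihilates)
                                                            (proj₂ (annihilator-count d v b li)))
    where
    zero-annihilates : ∀ c → vec c ≈ᵥ 0ᵥ → Ann b c
    zero-annihilates c z i = dot-zeroˡ (b i) z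

  -- F^v has q^v - 1 non-zero vectors (the case d = 0).
  nonzero-count : ∀ v → ΣW v (λ c → ind (nonzero? c)) ≡ q ℕ.^ v ℕ.∸ 1
  nonzero-count v = ≡.trans (ΣW-cong v (λ c → ind-⇔ _ (nonzero? c ×-dec Ann? none c) (λ nz → nz , λ ()) proj₁))
                            (nonzero-annihilator-count none (λ _ _ ()))
    where
    none : Fin 0 → Vect v
    none ()

  nonzero-span-count : ∀ {k v} (B : Fin k → Vect v) → LinIndep B →
    ΣW v (λ c → ind (nonzero? c ×-dec InSpan? B c)) ≡ q ℕ.^ k ℕ.∸ 1
  nonzero-span-count {k} {v} B li = pred-of (≡.trans (count-nonzero v (InSpan? B) (zero-in-span B)) (span-count B li))

module DoubleCounting (R : CommutativeRing 0ℓ 0ℓ) (isField : IsField R) (q : ℕ) (size : HasSize R q)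
  (k v n : ℕ) (N : Fin n → Linear.Vect R v → Set)
  (dimN : ∀ j → Linear.HasDim R (N j) k) (trivial : Linear.PairwiseTrivial R N) (r : ℕ)
  (regular : ∀ H → Linear.IsHyperplane R H → Linear.ContainsExactly R H N r) where

  open import Data.Nat using (_+_; _*_; _^_; _∸_; _≤_; s≤s; z≤n)
  open import Data.Nat.Properties using (*-comm; *-assoc; *-zeroʳ; *-identityˡ; ≤-trans)
  import Data.Fin as F
  import Data.Fin.Properties as FP
  open import Data.Fin.Subset using (∣_∣)
  open import Data.Fin.Subset.Properties using (_∈?_)
  open import Data.Product using (∃-syntax; _×_; _,_; proj₁; proj₂)
  open import Data.Empty using (⊥-elim)
  open import Relation.Nullary using (¬_; yes; no; _×-dec_)
  open import Relation.Binary.PropositionalEquality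
  open import Data.Vec.Functional using (_++_)
  open import Function using (_∘_)
  open Linear R
  open Indicators using (∑ℕ; ind; ind-⇔; ind-no; ind-×; ∑ℕ-cong; ∑ℕ-const; ∑ℕ-unique; ∑ℕ-except; size-∑ℕ; *-distribˡ-sum)
  open WordSums q
  open FiniteField R isField q size
  module R = CommutativeRing R

  B : ∀ j → Fin k → Vect v
  B j = proj₁ (proj₂ (dimN j))

  B-basis : ∀ j → IsBasis (N j) (B j)
  B-basis j = proj₂ (proj₂ (dimN j))

  B-independent : ∀ j → LinIndep (B j)
  B-independent j = proj₁ (B-basis j)

  I A : Fin n → Word v → ℕ
  I j c = ind (Ann? (B j) c)
  A j c = ind (nonzero? c ×-dec Ann? (B j) c)

  -- Each non-zero c annihilates exactly r members: those inside the hyperplane ker(c).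
  annihilated-members : ∀ c → ind (nonzero? c) * r ≡ ∑ℕ {n} (λ j → A j c)
  annihilated-members c with nonzero? c
  ... | no z = sym (trans (∑ℕ-cong n (λ j → ind-no (no z ×-dec Ann? (B j) c) (z ∘ proj₁))) (trans (∑ℕ-const n 0) (*-zeroʳ n)))
  ... | yes nz = let (S , |S|≡r , S-spec) = regular (Ker (vec c)) (kernel-hyperplane (vec c) nz) in begin
    1 * r ≡⟨ *-identityˡ r ⟩
    r ≡⟨ sym |S|≡r ⟩
    ∣ S ∣ ≡⟨ size-∑ℕ n S ⟩
    ∑ℕ {n} (λ j → ind (j ∈? S)) ≡⟨ ∑ℕ-cong n (λ j → ind-⇔ (j ∈? S) (yes nz ×-dec Ann? (B j) c)
         (λ j∈S → nz , proj₁ (⊆Ker⇔ (N j) (B j) (B-basis j) (vec c)) (proj₁ (S-spec j) j∈S))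
         (λ { (_ , ann) → proj₂ (S-spec j) (proj₂ (⊆Ker⇔ (N j) (B j) (B-basis j) (vec c)) ann) })) ⟩
    ∑ℕ {n} (λ j → ind (yes nz ×-dec Ann? (B j) c)) ∎
    where open ≡-Reasoning

  member-annihilators : ∀ j → ΣW v (A j) ≡ q ^ (v ∸ k) ∸ 1
  member-annihilators j = nonzero-annihilator-count (B j) (B-independent j)

  -- Counting pairs (c, j) with c ≠ 0 annihilating N_j: r (q^v - 1) = n (q^(v-k) - 1).
  hyperplane-incidences : r * (q ^ v ∸ 1) ≡ n * (q ^ (v ∸ k) ∸ 1)
  hyperplane-incidences = begin
    r * (q ^ v ∸ 1) ≡⟨ cong (r *_) (sym (nonzero-count v)) ⟩
    r * ΣW v (λ c → ind (nonzero? c)) ≡⟨ ΣW-*ˡ v r _ ⟩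
    ΣW v (λ c → r * ind (nonzero? c)) ≡⟨ ΣW-cong v (λ c → trans (*-comm r _) (annihilated-members c)) ⟩
    ΣW v (λ c → ∑ℕ {n} (λ j → A j c)) ≡⟨ ΣW-∑ℕ v n (λ c j → A j c) ⟩
    ∑ℕ {n} (λ j → ΣW v (A j)) ≡⟨ ∑ℕ-cong n member-annihilators ⟩
    ∑ℕ {n} (λ _ → q ^ (v ∸ k) ∸ 1) ≡⟨ ∑ℕ-const n _ ⟩
    n * (q ^ (v ∸ k) ∸ 1) ∎
    where open ≡-Reasoning

  pair-independent : ∀ j l → l ≢ j → LinIndep (B j ++ B l)
  pair-independent j l l≢j = indep-++ (N j) (N l) (B j) (B l) (B-basis j) (B-basis l) (proj₁ (dimN l))
                                      (λ x → trivial j l (l≢j ∘ sym) x)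

  -- Two distinct members together span a 2k-dimensional subspace, so 2k ≤ v.
  pair-dimension : ∀ j l → l ≢ j → k + k ≤ v
  pair-dimension j l l≢j = proj₁ (annihilator-count (k + k) v (B j ++ B l) (pair-independent j l l≢j))

  pair-annihilators : ∀ j l → ΣW v (λ c → I j c * A l c) ≡ ΣW v (λ c → ind (nonzero? c ×-dec Ann? (B j ++ B l) c))
  pair-annihilators j l = ΣW-cong v λ c → trans (sym (ind-× (Ann? (B j) c) (nonzero? c ×-dec Ann? (B l) c)))
    (ind-⇔ _ _ (λ { (aj , nz , al) → nz , Ann-++⁻¹ (B j) (B l) c aj al })
               (λ { (nz , a) → proj₁ (Ann-++ (B j) (B l) c a) , nz , proj₂ (Ann-++ (B j) (B l) c a) }))

  distinct-pair-count : ∀ j l → l ≢ j → ΣW v (λ c → I j c * A l c) ≡ q ^ (v ∸ (k + k)) ∸ 1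
  distinct-pair-count j l l≢j = trans (pair-annihilators j l) (nonzero-annihilator-count (B j ++ B l) (pair-independent j l l≢j))

  equal-pair-count : ∀ j → ΣW v (λ c → I j c * A j c) ≡ q ^ (v ∸ k) ∸ 1
  equal-pair-count j = trans (ΣW-cong v λ c → trans (sym (ind-× (Ann? (B j) c) (nonzero? c ×-dec Ann? (B j) c)))
                                                   (ind-⇔ _ _ proj₂ (λ { (nz , a) → a , nz , a })))
                             (member-annihilators j)

  -- The same count among the c annihilating a fixed member N_j:
  -- r (q^(v-k) - 1) = (q^(v-k) - 1) + (n - 1)(q^(v-2k) - 1), written without subtraction.
  pencil-incidences : ∀ j → r * (q ^ (v ∸ k) ∸ 1) + (q ^ (v ∸ (k + k)) ∸ 1) ≡ (q ^ (v ∸ k) ∸ 1) + n * (q ^ (v ∸ (k + k)) ∸ 1)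
  pencil-incidences j = begin
    r * (q ^ (v ∸ k) ∸ 1) + Cm ≡⟨ cong (λ x → r * x + Cm) (sym (member-annihilators j)) ⟩
    r * ΣW v (A j) + Cm ≡⟨ cong (_+ Cm) (trans (ΣW-*ˡ v r (A j)) (ΣW-cong v restrict)) ⟩
    ΣW v (λ c → ∑ℕ {n} (λ l → I j c * A l c)) + Cm ≡⟨ cong (_+ Cm) (ΣW-∑ℕ v n (λ c l → I j c * A l c)) ⟩
    ∑ℕ {n} (λ l → ΣW v (λ c → I j c * A l c)) + Cm ≡⟨ ∑ℕ-except n _ j Cm distinct-pair-count' ⟩
    ΣW v (λ c → I j c * A j c) + n * Cm ≡⟨ cong (_+ n * Cm) (equal-pair-count j) ⟩
    (q ^ (v ∸ k) ∸ 1) + n * Cm ∎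
    where
    open ≡-Reasoning
    Cm = q ^ (v ∸ (k + k)) ∸ 1
    distinct-pair-count' : ∀ l → l ≢ j → ΣW v (λ c → I j c * A l c) ≡ Cm
    distinct-pair-count' l = distinct-pair-count j l
    restrict : ∀ c → r * A j c ≡ ∑ℕ {n} (λ l → I j c * A l c)
    restrict c = begin
      r * A j c ≡⟨ cong (r *_) (ind-× (nonzero? c) (Ann? (B j) c)) ⟩
      r * (ind (nonzero? c) * I j c) ≡⟨ *-comm r _ ⟩
      ind (nonzero? c) * I j c * r ≡⟨ cong (_* r) (*-comm _ (I j c)) ⟩
      I j c * ind (nonzero? c) * r ≡⟨ *-assoc (I j c) _ r ⟩
      I j c * (ind (nonzero? c) * r) ≡⟨ cong (I j c *_) (annihilated-members c) ⟩
      I j c * ∑ℕ {n} (λ l → A l c) ≡⟨ *-distribˡ-sum (I j c) (λ l → A l c) ⟩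
      ∑ℕ {n} (λ l → I j c * A l c) ∎

  pencil-incidences-nonempty : 1 ≤ n → r * (q ^ (v ∸ k) ∸ 1) + (q ^ (v ∸ (k + k)) ∸ 1) ≡ (q ^ (v ∸ k) ∸ 1) + n * (q ^ (v ∸ (k + k)) ∸ 1)
  pencil-incidences-nonempty 1≤n = pencil-incidences (F.fromℕ< 1≤n)

  2k≤v-two-members : 2 ≤ n → k + k ≤ v
  2k≤v-two-members 2≤n = pair-dimension (F.fromℕ< {0} 1≤n) (F.fromℕ< {1} 2≤n) (λ e → 1≢0 (FP.fromℕ<-injective 1 0 2≤n 1≤n e))
    where
    1≤n = ≤-trans (s≤s z≤n) 2≤n
    1≢0 : ¬ (1 ≡ 0)
    1≢0 ()

  -- Members cover: a non-zero word lies in at most one member, since members meet in 0.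
  InMember : Word v → Set
  InMember c = ∃[ j ] InSpan (B j) c

  in-member-of : ∀ {j} c → InSpan (B j) c → N j (vec c)
  in-member-of {j} c (d , e) = proj₂ (proj₂ (B-basis j) (vec c)) (vec d , e)

  member-covering : ∀ c → ∑ℕ {n} (λ j → ind (nonzero? c ×-dec InSpan? (B j) c)) ≡ ind (nonzero? c ×-dec FP.any? (λ j → InSpan? (B j) c))
  member-covering c = trans (∑ℕ-unique n (λ j → nonzero? c ×-dec InSpan? (B j) c) at-most-one (FP.any? (λ j → nonzero? c ×-dec InSpan? (B j) c)))
                            (ind-⇔ _ _ (λ { (j , nz , m) → nz , j , m }) (λ { (nz , j , m) → j , nz , m }))
    where
    at-most-one : ∀ j j' → ¬ (vec c ≈ᵥ 0ᵥ) × InSpan (B j) c → ¬ (vec c ≈ᵥ 0ᵥ) × InSpan (B j') c → j ≡ j'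
    at-most-one j j' (nz , m) (_ , m') with j F.≟ j'
    ... | yes e = e
    ... | no ne = ⊥-elim (nz (trivial j j' ne (vec c) (in-member-of c m) (in-member-of c m')))

  -- If n (q^k - 1) = q^v - 1, the members, having q^k - 1 non-zero vectors each and
  -- being disjoint outside 0, cover all non-zero vectors exactly once.
  spread : n * (q ^ k ∸ 1) ≡ q ^ v ∸ 1 → IsSpread N
  spread count x x≉0 = j , x∈Nj , unique
    where
    covered-count : ΣW v (λ c → ind (nonzero? c ×-dec FP.any? (λ j → InSpan? (B j) c))) ≡ ΣW v (λ c → ind (nonzero? c))
    covered-count = begin
      ΣW v (λ c → ind (nonzero? c ×-dec FP.any? (λ j → InSpan? (B j) c))) ≡⟨ ΣW-cong v (λ c → sym (member-covering c)) ⟩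
      ΣW v (λ c → ∑ℕ {n} (λ j → ind (nonzero? c ×-dec InSpan? (B j) c))) ≡⟨ ΣW-∑ℕ v n _ ⟩
      ∑ℕ {n} (λ j → ΣW v (λ c → ind (nonzero? c ×-dec InSpan? (B j) c))) ≡⟨ ∑ℕ-cong n (λ j → nonzero-span-count (B j) (B-independent j)) ⟩
      ∑ℕ {n} (λ _ → q ^ k ∸ 1) ≡⟨ trans (∑ℕ-const n _) count ⟩
      q ^ v ∸ 1 ≡⟨ sym (nonzero-count v) ⟩
      ΣW v (λ c → ind (nonzero? c)) ∎
      where open ≡-Reasoning
    c = word x
    x-covered : InMember c
    x-covered = ΣW-full v nonzero? (λ c → FP.any? (λ j → InSpan? (B j) c)) covered-count c
                        (λ z → x≉0 (λ i → R.trans (R.sym (vec-word x i)) (z i)))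
    j = proj₁ x-covered
    x∈Nj : N j x
    x∈Nj = IsSubspace.resp (proj₁ (dimN j)) (vec-word x) (in-member-of c (proj₂ x-covered))
    unique : ∀ j' → N j' x → j' ≡ j
    unique j' x∈Nj' with j' F.≟ j
    ... | yes e = e
    ... | no ne = ⊥-elim (x≉0 (trivial j' j ne x x∈Nj' x∈Nj))

module Arithmetic (q : ℕ) (2≤q : 2 ≤ q) where

  open import Data.Nat
  open import Data.Nat.Properties
  open import Data.Nat.Induction using (<-rec)
  open import Data.Nat.Divisibility using (_∣_; divides; ∣⇒≤; ∣m+n∣m⇒∣n; m∣m*n; ∣-refl; ∣m∣n⇒∣m+n)
  open import Data.Product using (∃-syntax; _×_; _,_; proj₁; proj₂)
  open import Data.Empty using (⊥-elim)
  open import Relation.Nullary using (yes; no)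
  open import Relation.Binary.PropositionalEquality
  open import Data.Nat.Solver using (module +-*-Solver)
  open +-*-Solver

  instance
    q-nonZero : NonZero q
    q-nonZero = >-nonZero (≤-trans (s≤s z≤n) 2≤q)

  -- With a ≥ 1, b = a g + a + g and κ = a b + a + b (that is, b + 1 = (a + 1)(g + 1) and
  -- κ + 1 = (a + 1)(b + 1)), the equations r κ = n b and r b + g = b + n g force
  -- r a = b and n a = κ.  With F = (g + 1) a², the polynomial identity below turns them
  -- into r a F = b F.
  solve-incidences : ∀ r n a b g κ → 1 ≤ a → b ≡ a * g + a + g → κ ≡ a * b + a + b →
    r * κ ≡ n * b → r * b + g ≡ b + n * g → r * a ≡ b × n * a ≡ κ
  solve-incidences r n (suc a0) _ g _ _ refl refl E1 E2 = ra≡b , na≡κ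
    where
    a = suc a0
    b = a * g + a + g
    κ = a * b + a + b
    F = suc g * a * a
    identity : r * a * F + b * a * (b + n * g) + g * a * (r * κ) ≡ b * F + b * a * (r * b + g) + g * a * (n * b)
    identity = solve 4 (λ r n a g → let b = a :* g :+ a :+ g ; κ = a :* b :+ a :+ b ; F = (con 1 :+ g) :* a :* a in
        r :* a :* F :+ b :* a :* (b :+ n :* g) :+ g :* a :* (r :* κ) :=
        b :* F :+ b :* a :* (r :* b :+ g) :+ g :* a :* (n :* b)) refl r n a g
    same-tails : r * a * F + b * a * (r * b + g) + g * a * (n * b) ≡ b * F + b * a * (r * b + g) + g * a * (n * b)
    same-tails = trans (cong₂ (λ x y → r * a * F + b * a * x + g * a * y) E2 (sym E1)) identity
    ra≡b : r * a ≡ b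
    ra≡b = *-cancelʳ-≡ (r * a) b F (+-cancelʳ-≡ _ _ _ (+-cancelʳ-≡ _ _ _ same-tails))
    b-nonZero : NonZero b
    b-nonZero = >-nonZero (≤-trans (s≤s z≤n) (≤-trans (m≤n+m a (a * g)) (m≤m+n (a * g + a) g)))
    na≡κ : n * a ≡ κ
    na≡κ = *-cancelʳ-≡ (n * a) κ b {{b-nonZero}} (begin
      n * a * b ≡⟨ solve 3 (λ n a b → n :* a :* b := n :* b :* a) refl n a b ⟩
      n * b * a ≡⟨ cong (_* a) (sym E1) ⟩
      r * κ * a ≡⟨ solve 3 (λ r κ a → r :* κ :* a := r :* a :* κ) refl r κ a ⟩
      r * a * κ ≡⟨ cong (_* κ) ra≡b ⟩
      b * κ ≡⟨ *-comm b κ ⟩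
      κ * b ∎)
      where open ≡-Reasoning

  -- xy - 1 = (x-1)(y-1) + (x-1) + (y-1): the shape of b and κ in solve-incidences.
  pred-* : ∀ x y → 1 ≤ x → 1 ≤ y → x * y ∸ 1 ≡ (x ∸ 1) * (y ∸ 1) + (x ∸ 1) + (y ∸ 1)
  pred-* (suc x) (suc y) _ _ = solve 2 (λ x y → y :+ x :* (con 1 :+ y) := x :* y :+ x :+ y) refl x y

  1≤q^ : ∀ m → 1 ≤ q ^ m
  1≤q^ m = m^n>0 q m

  1≤q^-1 : ∀ m → 1 ≤ m → 1 ≤ q ^ m ∸ 1
  1≤q^-1 m 1≤m = ≤-trans (s≤s z≤n) (∸-monoˡ-≤ 1 (≤-trans 2≤q (≤-trans (≤-reflexive (sym (*-identityʳ q))) (^-monoʳ-≤ q 1≤m))))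

  pred-pow : ∀ s t → s ≤ t → q ^ t ∸ 1 ≡ (q ^ s ∸ 1) * (q ^ (t ∸ s) ∸ 1) + (q ^ s ∸ 1) + (q ^ (t ∸ s) ∸ 1)
  pred-pow s t s≤t = trans (cong (λ e → q ^ e ∸ 1) (sym (m+[n∸m]≡n s≤t)))
                           (trans (cong (_∸ 1) (^-distribˡ-+-* q s (t ∸ s))) (pred-* (q ^ s) (q ^ (t ∸ s)) (1≤q^ s) (1≤q^ (t ∸ s))))

  spread-equations : ∀ k v r n → 1 ≤ k → k < v → 0 < r →
    r * (q ^ v ∸ 1) ≡ n * (q ^ (v ∸ k) ∸ 1) →
    (1 ≤ n → r * (q ^ (v ∸ k) ∸ 1) + (q ^ (v ∸ (k + k)) ∸ 1) ≡ (q ^ (v ∸ k) ∸ 1) + n * (q ^ (v ∸ (k + k)) ∸ 1)) →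
    (2 ≤ n → k + k ≤ v) →
    k + k ≤ v × n * (q ^ k ∸ 1) ≡ q ^ v ∸ 1 × r * (q ^ k ∸ 1) ≡ q ^ (v ∸ k) ∸ 1
  spread-equations k v r n 1≤k k<v 0<r E1 E2 pair = cases n E1 E2 pair
    where
    a = q ^ k ∸ 1
    b = q ^ (v ∸ k) ∸ 1
    κ = q ^ v ∸ 1
    g = q ^ (v ∸ (k + k)) ∸ 1
    1≤a : 1 ≤ a
    1≤a = 1≤q^-1 k 1≤k
    1≤b : 1 ≤ b
    1≤b = 1≤q^-1 (v ∸ k) (m<n⇒0<n∸m k<v)
    κ-split : κ ≡ a * b + a + b
    κ-split = pred-pow k v (<⇒≤ k<v)
    b<κ : b < κ
    b<κ = subst (b <_) (sym κ-split) (m<n+m b (≤-trans 1≤a (m≤n+m a (a * b))))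
    cases : ∀ n → r * κ ≡ n * b → (1 ≤ n → r * b + g ≡ b + n * g) → (2 ≤ n → k + k ≤ v) →
      k + k ≤ v × n * a ≡ κ × r * a ≡ b
    -- no members: the hyperplane count r (q^v - 1) would vanish
    cases zero E1 _ _ = ⊥-elim (<⇒≢ (*-mono-≤ 0<r (≤-trans (s≤s z≤n) b<κ)) (sym E1))
    -- one member: then r = 1 and q^v - 1 = q^(v-k) - 1, impossible
    cases (suc zero) E1 E2 _ = ⊥-elim (<⇒≢ b<κ (sym (begin
      κ ≡⟨ sym (*-identityˡ κ) ⟩
      1 * κ ≡⟨ cong (_* κ) (sym r≡1) ⟩
      r * κ ≡⟨ E1 ⟩
      1 * b ≡⟨ *-identityˡ b ⟩
      b ∎)))
      where
      open ≡-Reasoning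
      r≡1 : r ≡ 1
      r≡1 = *-cancelʳ-≡ r 1 b {{>-nonZero 1≤b}}
        (trans (+-cancelʳ-≡ g _ _ (trans (E2 (s≤s z≤n)) (cong (b +_) (*-identityˡ g)))) (sym (*-identityˡ b)))
    -- at least two members: then 2k ≤ v, so also q^(v-k) - 1 splits, and the equations solve
    cases (suc (suc n')) E1 E2 pair = 2k≤v , proj₂ solved , proj₁ solved
      where
      2k≤v = pair (s≤s (s≤s z≤n))
      k≤v-k : k ≤ v ∸ k
      k≤v-k = ≤-trans (≤-reflexive (sym (m+n∸m≡n k k))) (∸-monoˡ-≤ k 2k≤v)
      b-split : b ≡ a * g + a + g
      b-split = trans (pred-pow k (v ∸ k) k≤v-k) (cong (λ e → a * (q ^ e ∸ 1) + a + (q ^ e ∸ 1)) (∸-+-assoc v k k))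
      solved = solve-incidences r (suc (suc n')) a b g κ 1≤a b-split κ-split E1 (E2 (s≤s z≤n))

  -- (q^k - 1) ∣ (q^v - 1) implies k ∣ v, by strong induction on v: for k ≤ v, the split
  -- q^v - 1 = (q^k - 1)(q^(v-k) - 1) + (q^k - 1) + (q^(v-k) - 1) passes the divisibility
  -- to v - k; for 0 < v < k, 0 < q^v - 1 < q^k - 1 excludes it.
  exponent-divides : ∀ k → 1 ≤ k → ∀ v → (q ^ k ∸ 1) ∣ (q ^ v ∸ 1) → k ∣ v
  exponent-divides k 1≤k = <-rec (λ v → (q ^ k ∸ 1) ∣ (q ^ v ∸ 1) → k ∣ v) step
    where
    a = q ^ k ∸ 1
    step : ∀ v → (∀ {w} → w < v → a ∣ (q ^ w ∸ 1) → k ∣ w) → a ∣ (q ^ v ∸ 1) → k ∣ v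
    step zero _ _ = divides 0 refl
    step (suc v) IH a∣ with k ≤? suc v
    ... | yes k≤v = subst (k ∣_) (m+[n∸m]≡n k≤v) (∣m∣n⇒∣m+n ∣-refl (IH (s≤s (∸-monoʳ-≤ (suc v) 1≤k)) a∣rest))
      where
      rest = q ^ (suc v ∸ k) ∸ 1
      a∣rest : a ∣ rest
      a∣rest = ∣m+n∣m⇒∣n (subst (a ∣_) (pred-pow k (suc v) k≤v) a∣) (∣m∣n⇒∣m+n (m∣m*n rest) ∣-refl)
    ... | no k≰v = ⊥-elim (<⇒≱ too-small (∣⇒≤ {{>-nonZero (1≤q^-1 (suc v) (s≤s z≤n))}} a∣))
      where
      too-small : q ^ suc v ∸ 1 < a
      too-small = ∸-monoˡ-< (^-monoʳ-< q 2≤q (≰⇒> k≰v)) (1≤q^ (suc v))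

  multiple : ∀ k v n → 1 ≤ k → k + k ≤ v → n * (q ^ k ∸ 1) ≡ q ^ v ∸ 1 → ∃[ s ] (2 ≤ s × v ≡ s * k)
  multiple k v n 1≤k 2k≤v count = s , 2≤s , v≡sk
    where
    open _∣_ (exponent-divides k 1≤k v (divides n (sym count))) renaming (quotient to s; equality to v≡sk)
    2≤s : 2 ≤ s
    2≤s = *-cancelʳ-≤ 2 s k {{>-nonZero 1≤k}} (subst₂ _≤_ (cong (k +_) (sym (+-identityʳ k))) v≡sk 2k≤v)

open import Data.Nat using (_<_; _*_; _^_; _∸_)
open import Data.Product using (∃-syntax; _×_; _,_; proj₁; proj₂)
open import Relation.Binary.PropositionalEquality using (_≡_)

lemma1 : (q : ℕ) → IsPrimePower q
    → (R : CommutativeRing 0ℓ 0ℓ) → IsField R → HasSize R q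
    → (k v : ℕ) → 1 ≤ k → k < v
    → (n : ℕ) (N : Fin n → Linear.Vect R v → Set)
    → (∀ j → Linear.HasDim R (N j) k)
    → Linear.PairwiseTrivial R N
    → Linear.Spans R N
    → (r : ℕ) → 0 < r
    → (∀ (H : Linear.Vect R v → Set) → Linear.IsHyperplane R H → Linear.ContainsExactly R H N r)
    → (∃[ s ] (2 ≤ s × v ≡ s * k))
      × Linear.IsSpread R N
      × r * (q ^ k ∸ 1) ≡ q ^ (v ∸ k) ∸ 1
lemma1 q _ R isField size k v 1≤k k<v n N dimN trivial _ r 0<r regular =
  multiple k v n 1≤k 2k≤v n-count , spread n-count , r-count
  where
  open DoubleCounting R isField q size k v n N dimN trivial r regular
  open Arithmetic q (FiniteField.2≤q R isField q size)
  solved = spread-equations k v r n 1≤k k<v 0<r hyperplane-incidences pencil-incidences-nonempty 2k≤v-two-members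
  2k≤v = proj₁ solved
  n-count = proj₁ (proj₂ solved)
  r-count = proj₂ (proj₂ solved)
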